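{- Let $G$ be a graph and $Q$ a clique of $G$. Then $$\theta(G)\ge\theta(G-Q)\ge\theta(G)-1,\qquad \alpha(G)\ge\alpha(G-Q)\ge\alpha(G)-1,\qquad \mathrm{gap}(G)+1\ge\mathrm{gap}(G-Q)\ge\mathrm{gap}(G)-1,$$ and there exists a chain of induced subgraphs of $G$ whose gaps are $\mathrm{gap}(G),\mathrm{gap}(G)-1,\dots,0$. Furthermore, if $G$ is gap-critical, then $$\theta(G-Q)=\theta(G)-1,\quad \alpha(G-Q)=\alpha(G),\quad \mathrm{gap}(G-Q)=\mathrm{gap}(G)-1.$$
   Context: All graphs are finite, simple and undirected. $\alpha(G)$ denotes the maximum size of a stable set, $\theta(G)$ the minimum number of cliques partitioning $V(G)$, and $\mathrm{gap}(G)=\theta(G)-\alpha(G)$. $G-Q$ denotes the subgraph induced by $V(G)\setminus Q$. A graph $G$ is gap-critical if $\mathrm{gap}(H)<\mathrm{gap}(G)$ for every proper induced subgraph $H$ of $G$. -}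

module Defs where

open import Data.Nat using (ℕ; suc; _≤_; _∸_)
open import Data.Integer using (ℤ; +_; _-_; _<_)
open import Data.Fin using (Fin; zero; suc; inject₁; toℕ)
open import Data.Fin.Subset using (Subset; _∈_; _⊆_; _⊂_; ⊤; ∣_∣; Nonempty)
open import Data.Product using (Σ; ∃; ∃-syntax; _×_)
open import Relation.Nullary using (¬_)
open import Relation.Binary.PropositionalEquality using (_≡_)

record Graph (n : ℕ) : Set₁ where
  field
    Adj   : Fin n → Fin n → Set
    sym   : ∀ {u v} → Adj u v → Adj v u
    irrefl : ∀ {u} → ¬ Adj u u
open Graph public

-- Induced subgraphs of G are identified with vertex subsets S ⊆ V(G) = ⊤.

IsClique : ∀ {n} → Graph n → Subset n → Set
IsClique G Q = Nonempty Q × (∀ u v → u ∈ Q → v ∈ Q → ¬ (u ≡ v) → Adj G u v)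

IsStable : ∀ {n} → Graph n → Subset n → Set
IsStable G T = ∀ u v → u ∈ T → v ∈ T → ¬ Adj G u v

record CliquePartition {n} (G : Graph n) (S : Subset n) (k : ℕ) : Set where
  field
    part     : Fin k → Subset n
    isClique : ∀ i → IsClique G (part i)
    inS      : ∀ i → part i ⊆ S
    disjoint : ∀ i j v → v ∈ part i → v ∈ part j → i ≡ j
    covers   : ∀ v → v ∈ S → ∃[ i ] (v ∈ part i)

IsAlpha : ∀ {n} → Graph n → Subset n → ℕ → Set
IsAlpha G S a =
  (∃[ T ] (T ⊆ S × IsStable G T × ∣ T ∣ ≡ a)) ×
  (∀ T → T ⊆ S → IsStable G T → ∣ T ∣ ≤ a)

IsTheta : ∀ {n} → Graph n → Subset n → ℕ → Set
IsTheta G S t = CliquePartition G S t × (∀ m → CliquePartition G S m → t ≤ m)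

IsGap : ∀ {n} → Graph n → Subset n → ℤ → Set
IsGap G S g = ∃[ a ] ∃[ t ] (IsAlpha G S a × IsTheta G S t × g ≡ (+ t) - (+ a))

GapCritical : ∀ {n} → Graph n → Set
GapCritical G = ∀ S → S ⊂ ⊤ → ∀ g g′ → IsGap G ⊤ g → IsGap G S g′ → g′ < g

-- Deleting a clique Q changes θ by at most one (put Q back as an extra part; conversely,
-- restricting a partition to V − Q and dropping the parts that become empty) and α by at most
-- one (a stable set meets a clique in at most one vertex); the gap bounds follow arithmetically.
-- If θ > α, a minimum clique partition has more parts than a maximum stable set T has vertices,
-- so by disjointness of the parts one of them misses T; deleting that part keeps α and lowers θ
-- by exactly one, and iterating gives the chain. For gap-critical G, gap(G − Q) < gap(G) together
-- with the bounds forces θ(G − Q) = θ(G) − 1 and α(G − Q) = α(G).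

module Submission where

open import Defs
open import Data.Nat using (ℕ; suc; _≤_; _∸_; _+_)
open import Data.Integer using (ℤ; +_; _-_) renaming (_≤_ to _≤ℤ_; _+_ to _+ℤ_)
open import Data.Fin using (Fin; zero; suc; inject₁; toℕ)
open import Data.Fin.Subset using (Subset; _⊆_; ⊤; ∁)
open import Data.Product using (∃-syntax; Σ-syntax; _×_)
open import Relation.Binary.PropositionalEquality using (_≡_)

open import Data.Empty using (⊥-elim)
open import Data.Fin using (_≟_; punchIn; punchOut)
import Data.Fin.Properties as Fin
open import Data.Fin.Subset using (_∈_; _∉_; _⊂_; _∩_; _─_; ⁅_⁆; ∣_∣; inside; outside)
open import Data.Fin.Subset.Properties
open import Data.Integer using (_⊖_) renaming (_<_ to _<ℤ_)
import Data.Integer.Properties as ℤ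
open import Data.Integer.Tactic.RingSolver using (solve-∀)
open import Data.Nat using (zero; z≤n; s≤s; _<_)
import Data.Nat.Properties as ℕ
open import Data.Product using (_,_; proj₁; proj₂)
open import Data.Vec using ([]; _∷_; here; there)
open import Function.Definitions using (Injective)
open import Relation.Nullary using (¬_; yes; no)
open import Relation.Binary.PropositionalEquality using (refl; trans; cong; subst; subst₂)
import Relation.Binary.PropositionalEquality as ≡

x∈p─q⇒x∉q : ∀ {n} {p q : Subset n} {x} → x ∈ p ─ q → x ∉ q
x∈p─q⇒x∉q {p = _ ∷ _} {inside ∷ _} () here
x∈p─q⇒x∉q {p = _ ∷ _} {_ ∷ _} (there x∈p─q) (there x∈q) = x∈p─q⇒x∉q x∈p─q x∈q

p⊆q⇒p─r⊆q─r : ∀ {n} {p q r : Subset n} → p ⊆ q → p ─ r ⊆ q ─ r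
p⊆q⇒p─r⊆q─r {p = p} {r = r} p⊆q x∈p─r = x∈p∧x∉q⇒x∈p─q (p⊆q (p─q⊆p p r x∈p─r)) (x∈p─q⇒x∉q x∈p─r)

⊤─p≡∁p : ∀ {n} (p : Subset n) → ⊤ ─ p ≡ ∁ p
⊤─p≡∁p []            = refl
⊤─p≡∁p (inside ∷ p)  = cong (outside ∷_) (⊤─p≡∁p p)
⊤─p≡∁p (outside ∷ p) = cong (inside ∷_) (⊤─p≡∁p p)

∣p∣≤∣p─q∣+∣q∣ : ∀ {n} (p q : Subset n) → ∣ p ∣ ≤ ∣ p ─ q ∣ + ∣ q ∣
∣p∣≤∣p─q∣+∣q∣ []            []            = z≤n
∣p∣≤∣p─q∣+∣q∣ (inside ∷ p)  (inside ∷ q)  =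
  ℕ.≤-trans (s≤s (∣p∣≤∣p─q∣+∣q∣ p q)) (ℕ.≤-reflexive (≡.sym (ℕ.+-suc ∣ p ─ q ∣ ∣ q ∣)))
∣p∣≤∣p─q∣+∣q∣ (inside ∷ p)  (outside ∷ q) = s≤s (∣p∣≤∣p─q∣+∣q∣ p q)
∣p∣≤∣p─q∣+∣q∣ (outside ∷ p) (inside ∷ q)  =
  ℕ.≤-trans (∣p∣≤∣p─q∣+∣q∣ p q) (ℕ.+-monoʳ-≤ ∣ p ─ q ∣ (ℕ.n≤1+n ∣ q ∣))
∣p∣≤∣p─q∣+∣q∣ (outside ∷ p) (outside ∷ q) = ∣p∣≤∣p─q∣+∣q∣ p q

injection⇒≤∣p∣ : ∀ {k n} (p : Subset n) (f : Fin k → Fin n) →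
                 (∀ i → f i ∈ p) → Injective _≡_ _≡_ f → k ≤ ∣ p ∣
injection⇒≤∣p∣ {zero}  p f f∈p f-inj = z≤n
injection⇒≤∣p∣ {suc k} p f f∈p f-inj =
  ℕ.≤-trans (s≤s (injection⇒≤∣p∣ (p ─ ⁅ f zero ⁆) (λ i → f (suc i)) f[suc]∈p-f0 f[suc]-inj))
            (x∈p⇒∣p-x∣<∣p∣ (f∈p zero))
  where
  f[suc]∈p-f0 : ∀ i → f (suc i) ∈ p ─ ⁅ f zero ⁆
  f[suc]∈p-f0 i = x∈p∧x≢y⇒x∈p-y (f∈p (suc i)) (λ eq → Fin.0≢1+n (≡.sym (f-inj eq)))
  f[suc]-inj : Injective _≡_ _≡_ (λ i → f (suc i))
  f[suc]-inj eq = Fin.suc-injective (f-inj eq)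

suc[d]≤suc[t]∸a⇒a≤t×d≤t∸a : ∀ {d t a} → suc d ≤ suc t ∸ a → a ≤ t × d ≤ t ∸ a
suc[d]≤suc[t]∸a⇒a≤t×d≤t∸a {d} {t} {a} d<1+t∸a = a≤t , ℕ.≤-pred (subst (suc d ≤_) (ℕ.+-∸-assoc 1 a≤t) d<1+t∸a)
  where
  a≤t : a ≤ t
  a≤t = ℕ.≤-pred (ℕ.m∸n≢0⇒n<m λ 1+t∸a≡0 → ℕ.<⇒≱ (subst (suc d ≤_) 1+t∸a≡0 d<1+t∸a) z≤n)

+m-+n≤+o-+p : ∀ m n o p → m + p ≤ o + n → + m - + n ≤ℤ + o - + p
+m-+n≤+o-+p m n o p m+p≤o+n = begin
  + m - + n        ≡⟨ ℤ.[+m]-[+n]≡m⊖n m n ⟩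
  m ⊖ n            ≡⟨ ℤ.+-cancelˡ-⊖ p m n ⟨
  p + m ⊖ (p + n)  ≤⟨ ℤ.⊖-monoˡ-≤ (p + n) p+m≤n+o ⟩
  n + o ⊖ (p + n)  ≡⟨ cong (n + o ⊖_) (ℕ.+-comm p n) ⟩
  n + o ⊖ (n + p)  ≡⟨ ℤ.+-cancelˡ-⊖ n o p ⟩
  o ⊖ p            ≡⟨ ℤ.[+m]-[+n]≡m⊖n o p ⟨
  + o - + p        ∎
  where
  open ℤ.≤-Reasoning
  p+m≤n+o : p + m ≤ n + o
  p+m≤n+o = subst₂ _≤_ (ℕ.+-comm m p) (ℕ.+-comm o n) m+p≤o+n

+m-+n<+o-+p⇒m+p<o+n : ∀ m n o p → + m - + n <ℤ + o - + p → m + p < o + n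
+m-+n<+o-+p⇒m+p<o+n m n o p lt = ℕ.≰⇒> λ o+n≤m+p → ℤ.<⇒≱ lt (+m-+n≤+o-+p o p m n o+n≤m+p)

[+t-+a]-+i≡+[t∸i]-+a : ∀ {t i} a → i ≤ t → (+ t - + a) - + i ≡ + (t ∸ i) - + a
[+t-+a]-+i≡+[t∸i]-+a {t} {i} a i≤t = begin
  (+ t - + a) - + i  ≡⟨ swap (+ t) (+ a) (+ i) ⟩
  (+ t - + i) - + a  ≡⟨ cong (_- + a) (ℤ.[+m]-[+n]≡m⊖n t i) ⟩
  t ⊖ i - + a        ≡⟨ cong (_- + a) (ℤ.⊖-≥ i≤t) ⟩
  + (t ∸ i) - + a    ∎
  where
  open ≡.≡-Reasoning
  swap : ∀ x y z → (x - y) - z ≡ (x - z) - y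
  swap = solve-∀

gap-upper : ∀ {t t′ a a′} → t′ ≤ t → a ≤ a′ + 1 → + t′ - + a′ ≤ℤ (+ t - + a) +ℤ + 1
gap-upper {t} {t′} {a} {a′} t′≤t a≤a′+1 = begin
  + t′ - + a′          ≤⟨ +m-+n≤+o-+p t′ a′ (t + 1) a t′+a≤t+1+a′ ⟩
  + (t + 1) - + a      ≡⟨ cong (_- + a) (ℤ.pos-+ t 1) ⟩
  (+ t +ℤ + 1) - + a   ≡⟨ shift (+ t) (+ a) ⟩
  (+ t - + a) +ℤ + 1   ∎
  where
  open ℤ.≤-Reasoning
  shift : ∀ x y → (x +ℤ + 1) - y ≡ (x - y) +ℤ + 1
  shift = solve-∀
  t′+a≤t+1+a′ : t′ + a ≤ t + 1 + a′
  t′+a≤t+1+a′ = subst (t′ + a ≤_) (trans (cong (λ x → t + x) (ℕ.+-comm a′ 1)) (≡.sym (ℕ.+-assoc t 1 a′)))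
                      (ℕ.+-mono-≤ t′≤t a≤a′+1)

gap-lower : ∀ {t t′ a a′} → t ≤ t′ + 1 → a′ ≤ a → (+ t - + a) - + 1 ≤ℤ + t′ - + a′
gap-lower {t} {t′} {a} {a′} t≤t′+1 a′≤a = begin
  (+ t - + a) - + 1    ≡⟨ shift (+ t) (+ a) ⟩
  + t - (+ a +ℤ + 1)   ≡⟨ cong (+ t -_) (ℤ.pos-+ a 1) ⟨
  + t - + (a + 1)      ≤⟨ +m-+n≤+o-+p t (a + 1) t′ a′ t+a′≤t′+[a+1] ⟩
  + t′ - + a′          ∎
  where
  open ℤ.≤-Reasoning
  shift : ∀ x y → (x - y) - + 1 ≡ x - (y +ℤ + 1)
  shift = solve-∀
  t+a′≤t′+[a+1] : t + a′ ≤ t′ + (a + 1)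
  t+a′≤t′+[a+1] = subst (t + a′ ≤_) (trans (ℕ.+-assoc t′ 1 a) (cong (λ x → t′ + x) (ℕ.+-comm 1 a)))
                        (ℕ.+-mono-≤ t≤t′+1 a′≤a)

gap-strict-decrease : ∀ {t t′ a a′} → t ≤ t′ + 1 → a′ ≤ a → + t′ - + a′ <ℤ + t - + a →
                      (t′ + 1 ≡ t) × (a′ ≡ a) × (+ t′ - + a′ ≡ (+ t - + a) - + 1)
gap-strict-decrease {t} {t′} {a} {a′} t≤t′+1 a′≤a gap-drop = t′+1≡t , a′≡a , gap′≡gap-1
  where
  t′+a<t+a′ : t′ + a < t + a′
  t′+a<t+a′ = +m-+n<+o-+p⇒m+p<o+n t′ a′ t a gap-drop
  a≤a′ : a ≤ a′
  a≤a′ = ℕ.+-cancelˡ-≤ t′ a a′ (ℕ.≤-pred (begin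
    suc (t′ + a)   ≤⟨ t′+a<t+a′ ⟩
    t + a′         ≤⟨ ℕ.+-monoˡ-≤ a′ t≤t′+1 ⟩
    t′ + 1 + a′    ≡⟨ trans (ℕ.+-assoc t′ 1 a′) (ℕ.+-suc t′ a′) ⟩
    suc (t′ + a′)  ∎))
    where open ℕ.≤-Reasoning
  a′≡a : a′ ≡ a
  a′≡a = ℕ.≤-antisym a′≤a a≤a′
  t′<t : t′ < t
  t′<t = ℕ.+-cancelʳ-< a t′ t (subst (λ x → t′ + a < t + x) a′≡a t′+a<t+a′)
  t′+1≡t : t′ + 1 ≡ t
  t′+1≡t = ℕ.≤-antisym (subst (_≤ t) (ℕ.+-comm 1 t′) t′<t) t≤t′+1
  gap′≡gap-1 : + t′ - + a′ ≡ (+ t - + a) - + 1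
  gap′≡gap-1 = begin
    + t′ - + a′                    ≡⟨ cong (λ x → + t′ - + x) a′≡a ⟩
    + t′ - + a                     ≡⟨ shift (+ t′) (+ a) ⟩
    ((+ t′ +ℤ + 1) - + a) - + 1    ≡⟨ cong (λ x → (x - + a) - + 1) (ℤ.pos-+ t′ 1) ⟨
    (+ (t′ + 1) - + a) - + 1       ≡⟨ cong (λ x → (+ x - + a) - + 1) t′+1≡t ⟩
    (+ t - + a) - + 1              ∎
    where
    open ≡.≡-Reasoning
    shift : ∀ x y → x - y ≡ ((x +ℤ + 1) - y) - + 1
    shift = solve-∀

module _ {n} (G : Graph n) where

  open CliquePartition

  stable∩clique-unique : ∀ {T Q x y} → IsStable G T → IsClique G Q →
                         x ∈ T → x ∈ Q → y ∈ T → y ∈ Q → x ≡ y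
  stable∩clique-unique {x = x} {y} T-stable (_ , Q-adj) x∈T x∈Q y∈T y∈Q with x ≟ y
  ... | yes x≡y = x≡y
  ... | no  x≢y = ⊥-elim (T-stable x y x∈T y∈T (Q-adj x y x∈Q y∈Q x≢y))

  stable∣T∣≤∣T─clique∣+1 : ∀ {T Q} → IsStable G T → IsClique G Q → ∣ T ∣ ≤ ∣ T ─ Q ∣ + 1
  stable∣T∣≤∣T─clique∣+1 {T} {Q} T-stable Q-clique with nonempty? (T ∩ Q)
  ... | no T∩Q-empty = ℕ.≤-trans (p⊆q⇒∣p∣≤∣q∣ T⊆T─Q) (ℕ.m≤m+n ∣ T ─ Q ∣ 1)
    where
    T⊆T─Q : T ⊆ T ─ Q
    T⊆T─Q y∈T = x∈p∧x∉q⇒x∈p─q y∈T (λ y∈Q → T∩Q-empty (_ , x∈p∩q⁺ (y∈T , y∈Q)))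
  ... | yes (x , x∈T∩Q) = begin
    ∣ T ∣                     ≤⟨ ∣p∣≤∣p─q∣+∣q∣ T ⁅ x ⁆ ⟩
    ∣ T ─ ⁅ x ⁆ ∣ + ∣ ⁅ x ⁆ ∣ ≡⟨ cong (λ k → ∣ T ─ ⁅ x ⁆ ∣ + k) (∣⁅x⁆∣≡1 x) ⟩
    ∣ T ─ ⁅ x ⁆ ∣ + 1         ≤⟨ ℕ.+-monoˡ-≤ 1 (p⊆q⇒∣p∣≤∣q∣ T─x⊆T─Q) ⟩
    ∣ T ─ Q ∣ + 1             ∎
    where
    open ℕ.≤-Reasoning
    T─x⊆T─Q : T ─ ⁅ x ⁆ ⊆ T ─ Q
    T─x⊆T─Q {y} y∈T─x = x∈p∧x∉q⇒x∈p─q y∈T λ y∈Q →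
      x∈p─q⇒x∉q y∈T─x (subst (_∈ ⁅ x ⁆) (stable∩clique-unique T-stable Q-clique
        (proj₁ (x∈p∩q⁻ T Q x∈T∩Q)) (proj₂ (x∈p∩q⁻ T Q x∈T∩Q)) y∈T y∈Q) (x∈⁅x⁆ x))
      where
      y∈T : y ∈ T
      y∈T = p─q⊆p T ⁅ x ⁆ y∈T─x

  α-mono : ∀ {S X a b} → X ⊆ S → IsAlpha G S a → IsAlpha G X b → b ≤ a
  α-mono X⊆S (_ , S-max) ((T , T⊆X , T-stable , refl) , _) = S-max T (λ v∈T → X⊆S (T⊆X v∈T)) T-stable

  α[S]≤α[S─Q]+1 : ∀ {S Q a b} → IsClique G Q → IsAlpha G S a → IsAlpha G (S ─ Q) b → a ≤ b + 1
  α[S]≤α[S─Q]+1 {Q = Q} Q-clique ((T , T⊆S , T-stable , refl) , _) (_ , S─Q-max) =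
    ℕ.≤-trans (stable∣T∣≤∣T─clique∣+1 T-stable Q-clique)
              (ℕ.+-monoˡ-≤ 1 (S─Q-max (T ─ Q) (p⊆q⇒p─r⊆q─r T⊆S) T─Q-stable))
    where
    T─Q-stable : IsStable G (T ─ Q)
    T─Q-stable u v u∈ v∈ = T-stable u v (p─q⊆p T Q u∈) (p─q⊆p T Q v∈)

  CliquePartition-resp : ∀ {S S′ m} → S ⊆ S′ → S′ ⊆ S → CliquePartition G S m → CliquePartition G S′ m
  CliquePartition-resp S⊆S′ S′⊆S π = record
    { part     = part π
    ; isClique = isClique π
    ; inS      = λ i v∈ → S⊆S′ (inS π i v∈)
    ; disjoint = disjoint π
    ; covers   = λ v v∈S′ → covers π v (S′⊆S v∈S′)
    }

  insertClique : ∀ {S Q m} → IsClique G Q → Q ⊆ S → CliquePartition G (S ─ Q) m → CliquePartition G S (suc m)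
  insertClique {S} {Q} {m} Q-clique Q⊆S ρ = record
    { part = P ; isClique = P-clique ; inS = P⊆S ; disjoint = P-disjoint ; covers = P-covers }
    where
    P : Fin (suc m) → Subset n
    P zero    = Q
    P (suc i) = part ρ i
    P-clique : ∀ i → IsClique G (P i)
    P-clique zero    = Q-clique
    P-clique (suc i) = isClique ρ i
    P⊆S : ∀ i → P i ⊆ S
    P⊆S zero    = Q⊆S
    P⊆S (suc i) v∈ = p─q⊆p S Q (inS ρ i v∈)
    P-disjoint : ∀ i j v → v ∈ P i → v ∈ P j → i ≡ j
    P-disjoint zero    zero    v _   _   = refl
    P-disjoint zero    (suc j) v v∈Q v∈j = ⊥-elim (x∈p─q⇒x∉q (inS ρ j v∈j) v∈Q)
    P-disjoint (suc i) zero    v v∈i v∈Q = ⊥-elim (x∈p─q⇒x∉q (inS ρ i v∈i) v∈Q)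
    P-disjoint (suc i) (suc j) v v∈i v∈j = cong suc (disjoint ρ i j v v∈i v∈j)
    P-covers : ∀ v → v ∈ S → ∃[ i ] (v ∈ P i)
    P-covers v v∈S with v ∈? Q
    ... | yes v∈Q = zero , v∈Q
    ... | no  v∉Q with covers ρ v (x∈p∧x∉q⇒x∈p─q v∈S v∉Q)
    ...   | i , v∈i = suc i , v∈i

  deletePart : ∀ {S m} (π : CliquePartition G S (suc m)) (j : Fin (suc m)) → CliquePartition G (S ─ part π j) m
  deletePart {S} π j = record
    { part     = λ i → part π (punchIn j i)
    ; isClique = λ i → isClique π (punchIn j i)
    ; inS      = λ i v∈ → x∈p∧x∉q⇒x∈p─q (inS π _ v∈) (λ v∈j → Fin.punchInᵢ≢i j i (disjoint π _ _ _ v∈ v∈j))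
    ; disjoint = λ i k v v∈i v∈k → Fin.punchIn-injective j i k (disjoint π _ _ v v∈i v∈k)
    ; covers   = covers′
    }
    where
    covers′ : ∀ v → v ∈ S ─ part π j → ∃[ i ] (v ∈ part π (punchIn j i))
    covers′ v v∈S─j with covers π v (p─q⊆p S (part π j) v∈S─j)
    ... | i , v∈i = punchOut j≢i , subst (λ k → v ∈ part π k) (≡.sym (Fin.punchIn-punchOut j≢i)) v∈i
      where
      j≢i : ¬ j ≡ i
      j≢i refl = x∈p─q⇒x∉q v∈S─j v∈i

  restrict : ∀ {k S X} → X ⊆ S → CliquePartition G S k → ∃[ m ] (m ≤ k × CliquePartition G X m)
  restrict {zero} X⊆S π = 0 , z≤n , record
    { part = part π ; isClique = isClique π ; inS = λ () ; disjoint = disjoint π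
    ; covers = λ v v∈X → covers π v (X⊆S v∈X) }
  restrict {suc k} {S} {X} X⊆S π
    with restrict (p⊆q⇒p─r⊆q─r X⊆S) (deletePart π zero) | nonempty? (X ∩ part π zero)
  ... | m , m≤k , ρ | yes X∩P-nonempty =
    suc m , s≤s m≤k , insertClique X∩P-clique (p∩q⊆p X P) (CliquePartition-resp X─P⊆X─X∩P X─X∩P⊆X─P ρ)
    where
    P : Subset n
    P = part π zero
    X∩P-clique : IsClique G (X ∩ P)
    X∩P-clique = X∩P-nonempty , λ u v u∈ v∈ → proj₂ (isClique π zero) u v (p∩q⊆q X P u∈) (p∩q⊆q X P v∈)
    X─P⊆X─X∩P : X ─ P ⊆ X ─ (X ∩ P)
    X─P⊆X─X∩P v∈ = x∈p∧x∉q⇒x∈p─q (p─q⊆p X P v∈) (λ v∈X∩P → x∈p─q⇒x∉q v∈ (p∩q⊆q X P v∈X∩P))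
    X─X∩P⊆X─P : X ─ (X ∩ P) ⊆ X ─ P
    X─X∩P⊆X─P {v} v∈ = x∈p∧x∉q⇒x∈p─q v∈X (λ v∈P → x∈p─q⇒x∉q v∈ (x∈p∩q⁺ (v∈X , v∈P)))
      where
      v∈X : v ∈ X
      v∈X = p─q⊆p X (X ∩ P) v∈
  ... | m , m≤k , ρ | no X∩P-empty =
    m , ℕ.m≤n⇒m≤1+n m≤k , CliquePartition-resp (p─q⊆p X (part π zero)) X⊆X─P ρ
    where
    X⊆X─P : X ⊆ X ─ part π zero
    X⊆X─P v∈X = x∈p∧x∉q⇒x∈p─q v∈X (λ v∈P → X∩P-empty (_ , x∈p∩q⁺ (v∈X , v∈P)))

  θ-mono : ∀ {S X t t′} → X ⊆ S → IsTheta G S t → IsTheta G X t′ → t′ ≤ t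
  θ-mono X⊆S (π , _) (_ , X-min) with restrict X⊆S π
  ... | m , m≤t , ρ = ℕ.≤-trans (X-min m ρ) m≤t

  θ[S]≤θ[S─Q]+1 : ∀ {S Q t t′} → IsClique G Q → Q ⊆ S → IsTheta G S t → IsTheta G (S ─ Q) t′ → t ≤ t′ + 1
  θ[S]≤θ[S─Q]+1 {t = t} {t′} Q-clique Q⊆S (_ , S-min) (ρ , _) =
    subst (t ≤_) (ℕ.+-comm 1 t′) (S-min (suc t′) (insertClique Q-clique Q⊆S ρ))

  ∣T∣<k⇒∃part-disjoint : ∀ {S k} T (π : CliquePartition G S k) → ∣ T ∣ < k →
                         ∃[ j ] (∀ {v} → v ∈ part π j → v ∉ T)
  ∣T∣<k⇒∃part-disjoint {k = k} T π ∣T∣<k with Fin.all? (λ j → nonempty? (part π j ∩ T))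
  ... | yes meets = ⊥-elim (ℕ.<⇒≱ ∣T∣<k (injection⇒≤∣p∣ T witness witness∈T witness-inj))
    where
    witness : Fin k → Fin n
    witness j = proj₁ (meets j)
    witness∈part : ∀ j → witness j ∈ part π j
    witness∈part j = proj₁ (x∈p∩q⁻ (part π j) T (proj₂ (meets j)))
    witness∈T : ∀ j → witness j ∈ T
    witness∈T j = proj₂ (x∈p∩q⁻ (part π j) T (proj₂ (meets j)))
    witness-inj : Injective _≡_ _≡_ witness
    witness-inj {i} {j} eq = disjoint π i j (witness i) (witness∈part i)
                               (subst (_∈ part π j) (≡.sym eq) (witness∈part j))
  ... | no ¬meets with Fin.¬∀⟶∃¬ k _ (λ j → nonempty? (part π j ∩ T)) ¬meets
  ...   | j , ¬meets-j = j , λ v∈j v∈T → ¬meets-j (_ , x∈p∩q⁺ (v∈j , v∈T))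

  α<θ⇒∃clique-decrementing-θ : ∀ {S a t} → IsAlpha G S a → IsTheta G S (suc t) → a ≤ t →
                               ∃[ P ] (IsAlpha G (S ─ P) a × IsTheta G (S ─ P) t)
  α<θ⇒∃clique-decrementing-θ {S} {t = t} ((T , T⊆S , T-stable , refl) , S-max) (π , S-min) a≤t
    with ∣T∣<k⇒∃part-disjoint T π (s≤s a≤t)
  ... | j , P∩T-empty = P , α[S─P] , θ[S─P]
    where
    P : Subset n
    P = part π j
    α[S─P] : IsAlpha G (S ─ P) ∣ T ∣
    α[S─P] = (T , (λ v∈T → x∈p∧x∉q⇒x∈p─q (T⊆S v∈T) (λ v∈P → P∩T-empty v∈P v∈T)) , T-stable , refl)
           , λ T′ T′⊆S─P → S-max T′ (λ v∈T′ → p─q⊆p S P (T′⊆S─P v∈T′))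
    θ[S─P] : IsTheta G (S ─ P) t
    θ[S─P] = deletePart π j , λ m ρ → ℕ.≤-pred (S-min (suc m) (insertClique (isClique π j) (inS π j) ρ))

  cliqueDeletionChain :
    ∀ d {S a t} → IsAlpha G S a → IsTheta G S t → d ≤ t ∸ a →
    Σ[ H ∈ (Fin (suc d) → Subset n) ] (H zero ⊆ S × (∀ i → H (suc i) ⊆ H (inject₁ i)) ×
                                      (∀ i → IsAlpha G (H i) a × IsTheta G (H i) (t ∸ toℕ i)))
  cliqueDeletionChain zero {S} α θ _ = (λ _ → S) , (λ v∈S → v∈S) , (λ ()) , λ { zero → α , θ }
  cliqueDeletionChain (suc d) {a = a} {zero} α θ d<0∸a =
    ⊥-elim (ℕ.<⇒≱ (subst (suc d ≤_) (ℕ.0∸n≡0 a) d<0∸a) z≤n)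
  cliqueDeletionChain (suc d) {S} {a} {suc t} α θ d<1+t∸a
    with suc[d]≤suc[t]∸a⇒a≤t×d≤t∸a d<1+t∸a
  ... | a≤t , d≤t∸a with α<θ⇒∃clique-decrementing-θ α θ a≤t
  ... | P , α′ , θ′ with cliqueDeletionChain d α′ θ′ d≤t∸a
  ... | H , H0⊆S─P , H-nested , H-αθ = H⁺ , (λ v∈S → v∈S) , H⁺-nested , H⁺-αθ
    where
    H⁺ : Fin (suc (suc d)) → Subset n
    H⁺ zero    = S
    H⁺ (suc i) = H i
    H⁺-nested : ∀ i → H⁺ (suc i) ⊆ H⁺ (inject₁ i)
    H⁺-nested zero    v∈ = p─q⊆p S P (H0⊆S─P v∈)
    H⁺-nested (suc i) = H-nested i
    H⁺-αθ : ∀ i → IsAlpha G (H⁺ i) a × IsTheta G (H⁺ i) (suc t ∸ toℕ i)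
    H⁺-αθ zero    = α , θ
    H⁺-αθ (suc i) = H-αθ i

  gapChain : ∀ {S a t} → IsAlpha G S a → IsTheta G S t →
             Σ[ H ∈ (Fin (suc (t ∸ a)) → Subset n) ] ((∀ i → H (suc i) ⊆ H (inject₁ i)) ×
                                                   (∀ i → IsGap G (H i) ((+ t - + a) - + toℕ i)))
  gapChain {a = a} {t} α θ with cliqueDeletionChain (t ∸ a) α θ ℕ.≤-refl
  ... | H , _ , H-nested , H-αθ = H , H-nested , λ i →
    a , t ∸ toℕ i , proj₁ (H-αθ i) , proj₂ (H-αθ i) ,
    [+t-+a]-+i≡+[t∸i]-+a a (ℕ.≤-trans (Fin.toℕ≤pred[n] i) (ℕ.m∸n≤m t a))

proposition3p5 :
    ∀ {n} (G : Graph n) (Q : Subset n) → IsClique G Q →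
    ∀ (a a′ t t′ : ℕ) →
    IsAlpha G ⊤ a → IsAlpha G (∁ Q) a′ →
    IsTheta G ⊤ t → IsTheta G (∁ Q) t′ →
    (t′ ≤ t × t ≤ t′ + 1) ×
    (a′ ≤ a × a ≤ a′ + 1) ×
    (((+ t′) - (+ a′)) ≤ℤ (((+ t) - (+ a)) +ℤ (+ 1)) ×
     (((+ t) - (+ a)) - (+ 1)) ≤ℤ ((+ t′) - (+ a′))) ×
    (Σ[ H ∈ (Fin (suc (t ∸ a)) → Subset n) ] ((∀ (i : Fin (t ∸ a)) → H (suc i) ⊆ H (inject₁ i)) ×
             (∀ (i : Fin (suc (t ∸ a))) → IsGap G (H i) (((+ t) - (+ a)) - (+ toℕ i))))) ×
    (GapCritical G →
      (t′ + 1 ≡ t) × (a′ ≡ a) × ((+ t′) - (+ a′) ≡ ((+ t) - (+ a)) - (+ 1)))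
proposition3p5 G Q Q-clique a a′ t t′ αG αG-Q θG θG-Q =
  (t′≤t , t≤t′+1) , (a′≤a , a≤a′+1) , (gap-upper t′≤t a≤a′+1 , gap-lower t≤t′+1 a′≤a) , gapChain G αG θG ,
  λ critical → gap-strict-decrease t≤t′+1 a′≤a
                 (critical (∁ Q) ∁Q⊂⊤ _ _ (a , t , αG , θG , refl) (a′ , t′ , αG-Q , θG-Q , refl))
  where
  ⊤─Q≡∁Q : ⊤ ─ Q ≡ ∁ Q
  ⊤─Q≡∁Q = ⊤─p≡∁p Q
  t′≤t : t′ ≤ t
  t′≤t = θ-mono G ⊆⊤ θG θG-Q
  t≤t′+1 : t ≤ t′ + 1
  t≤t′+1 = θ[S]≤θ[S─Q]+1 G Q-clique ⊆⊤ θG (subst (λ X → IsTheta G X t′) (≡.sym ⊤─Q≡∁Q) θG-Q)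
  a′≤a : a′ ≤ a
  a′≤a = α-mono G ⊆⊤ αG αG-Q
  a≤a′+1 : a ≤ a′ + 1
  a≤a′+1 = α[S]≤α[S─Q]+1 G Q-clique αG (subst (λ X → IsAlpha G X a′) (≡.sym ⊤─Q≡∁Q) αG-Q)
  ∁Q⊂⊤ : ∁ Q ⊂ ⊤
  ∁Q⊂⊤ = ⊆⊤ , proj₁ (proj₁ Q-clique) , ∈⊤ , x∈p⇒x∉∁p (proj₂ (proj₁ Q-clique))
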